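{- For any set $\Gamma$ of axioms, any well-formed program $C$ and any $P,Q\subseteq\Sigma$: if $\Gamma\vdash\langle [P]\rangle\, C\,\langle\square Q\rangle$, then $\Gamma\vdash\langle\square P\rangle\, C\,\langle\square Q\rangle$.
   Context: Semiring: $\mathcal A=\langle U,+,\cdot,\mathbf 0,\mathbf 1\rangle$ is a partial semiring: $\langle U,+,\mathbf 0\rangle$ is a commutative monoid whose operation $+$ may be partial, $\langle U,\cdot,\mathbf 1\rangle$ is a (total) monoid, $\cdot$ distributes over $+$ on both sides, and $\mathbf 0\cdot u=u\cdot\mathbf 0=\mathbf 0$; naturally ordered ($u\le v$ iff $\exists w.\,u+w=v$ is a partial order), Scott continuous ($+$, both-sided $\cdot$ preserve directed suprema), with a top element; $\sum_{i\in I}u_i$ = supremum of finite partial sums. $\mathcal W(\Sigma)$: maps $m:\Sigma\to U$ with countable support $\mathrm{supp}(m)=\{\sigma:m(\sigma)\ne\mathbf 0\}$ and defined mass $|m|=\sum_{\sigma\in\mathrm{supp}(m)}m(\sigma)$; pointwise operations; $\eta(\sigma)$ point mass of weight $\mathbf 1$; $f^\dagger(m)(\tau)=\sum_{\sigma\in\mathrm{supp}(m)}m(\sigma)\cdot f(\sigma)(\tau)$. Programs: $C::=\mathsf{skip}\mid C_1;C_2\mid C_1+C_2\mid\mathsf{assume}\ e\mid C^{\langle e,e'\rangle}\mid a$ ($a$ atomic action with given $[\![a]\!]:\Sigma\to\mathcal W(\Sigma)$), $e::=b\mid u$, tests $b$ Boolean combinations ($\mathsf{true},\mathsf{false},\lor,\land,\neg$)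 of primitive tests $t\subseteq\Sigma$ evaluating to $\{\mathbf 0,\mathbf 1\}$. Semantics: $[\![\mathsf{skip}]\!]=\eta$, $[\![C_1;C_2]\!](\sigma)=[\![C_2]\!]^\dagger([\![C_1]\!](\sigma))$, $[\![C_1+C_2]\!](\sigma)=[\![C_1]\!](\sigma)+[\![C_2]\!](\sigma)$, $[\![\mathsf{assume}\ e]\!](\sigma)=[\![e]\!](\sigma)\cdot\eta(\sigma)$, $[\![C^{\langle e,e'\rangle}]\!]$ least fixed point of $\Phi(f)(\sigma)=[\![e]\!](\sigma)\cdot f^\dagger([\![C]\!](\sigma))+[\![e']\!](\sigma)\cdot\eta(\sigma)$; well-formed = total. Assertions: subsets of $\mathcal W(\Sigma)$; $\top,\bot,\land=\cap,\lor=\cup$, $\exists x{:}T.\phi(x)=\bigcup_t\phi(t)$, $\bigoplus_{x\in T}\phi(x)=\{\sum_t m_t: m_t\in\phi(t)\}$, binary $\oplus$, $u\odot\varphi=\{u\cdot m\}$, $\varphi\odot u=\{m\cdot u\}$. For $P\subseteq\Sigma$: $[P]_u=\{m:|m|=u,\mathrm{supp}(m)\subseteq P\}$, $[P]=[P]_{\mathbf 1}$, $\square P=\{m:\mathrm{supp}(m)\subseteq P\}$. $\varphi\models e=u$: $[\![e]\!](\sigma)=u$ for all $m\in\varphi,\sigma\in\mathrm{supp}(m)$. $(\psi_n)$ converges to $\psi_\infty$ if $m_n\in\psi_n\ \forall n$ implies $\sum_n m_n\in\psi_\infty$. Proof system $\Gamma\vdash$: axioms in $\Gamma$ (triples about atomic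 actions) plus rules (Skip) $\langle\varphi\rangle\mathsf{skip}\langle\varphi\rangle$; (Seq); (Plus) from $\langle\varphi\rangle C_i\langle\psi_i\rangle$ infer $\langle\varphi\rangle C_1+C_2\langle\psi_1\oplus\psi_2\rangle$; (Assume) if $\varphi\models e=u$ then $\langle\varphi\rangle\mathsf{assume}\ e\langle\varphi\odot u\rangle$; (Iter) if $(\psi_n)$ converges to $\psi_\infty$, and for all $n$, $\langle\varphi_n\rangle\mathsf{assume}\ e;C\langle\varphi_{n+1}\rangle$ and $\langle\varphi_n\rangle\mathsf{assume}\ e'\langle\psi_n\rangle$, then $\langle\varphi_0\rangle C^{\langle e,e'\rangle}\langle\psi_\infty\rangle$; (False) $\langle\bot\rangle C\langle\varphi\rangle$; (True) $\langle\varphi\rangle C\langle\top\rangle$; (Scale) from $\langle\varphi\rangle C\langle\psi\rangle$ infer $\langle u\odot\varphi\rangle C\langle u\odot\psi\rangle$; (Disj)/(Conj) combine two triples by $\lor$/$\land$; (Choice) from $\langle\phi(t)\rangle C\langle\phi'(t)\rangle\ \forall t\in T$ infer $\langle\bigoplus_x\phi(x)\rangle C\langle\bigoplus_x\phi'(x)\rangle$; (Exists) same with $\exists x{:}T$; (Consequence) if $\varphi'\subseteq\varphi$, $\langle\varphi\rangle C\langle\psi\rangle$, $\psi\subseteq\psi'$ then $\langle\varphi'\rangle C\langle\psi'\rangle$. -}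

module Defs where

open import Data.Nat using (ℕ; zero; suc)
open import Data.Bool using (Bool; true; false; if_then_else_; _∧_; _∨_; not)
open import Data.Maybe using (Maybe; just)
open import Data.List using (List; []; _∷_; map)
open import Data.List.Relation.Unary.Unique.Propositional using (Unique)
open import Data.Product using (Σ; ∃; _×_; _,_)
open import Data.Sum using (_⊎_)
open import Data.Unit using (⊤)
open import Data.Empty using (⊥)
open import Relation.Nullary using (¬_)
open import Relation.Binary.PropositionalEquality using (_≡_)

-- Carrier and operations.  The partial addition is given by its graph:
-- `Plus u v w` means "u + v is defined and equals w".
record RawPartialSemiring : Set₁ where
  field
    U    : Set
    Plus : U → U → U → Set
    𝟘    : U
    𝟙    : U
    _·_  : U → U → U

module RawDefs (R : RawPartialSemiring) where
  open RawPartialSemiring R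

  _≤_ : U → U → Set
  u ≤ v = ∃ λ w → Plus u w v

  IsSup : {D : Set} → (D → U) → U → Set
  IsSup d s = (∀ i → d i ≤ s) × (∀ b → (∀ i → d i ≤ b) → s ≤ b)

  Directed : {D : Set} → (D → U) → Set
  Directed {D} d = D × (∀ i j → ∃ λ k → (d i ≤ d k) × (d j ≤ d k))

  data FinSum : List U → U → Set where
    fs-[] : FinSum [] 𝟘
    fs-∷  : ∀ {x xs s r} → FinSum xs s → Plus x s r → FinSum (x ∷ xs) r

  IsSum : {I : Set} → (I → U) → U → Set
  IsSum {I} u s =
    (∀ (F : List I) → Unique F → ∃ λ t → FinSum (map u F) t × (t ≤ s))
    × (∀ b → (∀ (F : List I) → Unique F → ∀ t → FinSum (map u F) t → t ≤ b) → s ≤ b)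

record PartialSemiring : Set₁ where
  field
    raw : RawPartialSemiring
  open RawPartialSemiring raw public
  open RawDefs raw public
  field
    +-functional : ∀ {a b c c'} → Plus a b c → Plus a b c' → c ≡ c'
    +-comm       : ∀ {a b c} → Plus a b c → Plus b a c
    +-assoc      : ∀ {a b c ab r} → Plus a b ab → Plus ab c r →
                   ∃ λ bc → Plus b c bc × Plus a bc r
    +-identityʳ  : ∀ a → Plus a 𝟘 a
    ·-assoc      : ∀ a b c → (a · b) · c ≡ a · (b · c)
    ·-identityˡ  : ∀ a → 𝟙 · a ≡ a
    ·-identityʳ  : ∀ a → a · 𝟙 ≡ a
    distribˡ     : ∀ {a b c} d → Plus a b c → Plus (d · a) (d · b) (d · c)
    distribʳ     : ∀ {a b c} d → Plus a b c → Plus (a · d) (b · d) (c · d)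
    zeroˡ        : ∀ a → 𝟘 · a ≡ 𝟘
    zeroʳ        : ∀ a → a · 𝟘 ≡ 𝟘
    -- naturally ordered (≤ is reflexive and transitive by construction)
    ≤-antisym    : ∀ {a b} → a ≤ b → b ≤ a → a ≡ b
    +-continuous : ∀ {D : Set} (d : D → U) s u r (ds : D → U) → Directed d → IsSup d s →
                   Plus u s r → (∀ i → Plus u (d i) (ds i)) → IsSup ds r
    ·-continuousˡ : ∀ {D : Set} (d : D → U) s u → Directed d → IsSup d s →
                    IsSup (λ i → u · d i) (u · s)
    ·-continuousʳ : ∀ {D : Set} (d : D → U) s u → Directed d → IsSup d s →
                    IsSup (λ i → d i · u) (s · u)
    ⊤U           : U
    ≤-⊤          : ∀ a → a ≤ ⊤U

module OL (A : PartialSemiring) (St : Set) (Act : Set) where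
  open PartialSemiring A

  record W : Set where
    field
      fun       : St → U
      countable : Σ (ℕ → Maybe St) λ e → ∀ σ → ¬ (fun σ ≡ 𝟘) → ∃ λ n → e n ≡ just σ
      mass      : ∃ λ s → IsSum fun s
  open W public

  -- y is the value of the point mass η(σ) at τ (weight u at σ, 𝟘 elsewhere),
  -- i.e. (u · η(σ))(τ) = y
  PointVal : U → St → St → U → Set
  PointVal u σ τ y = (τ ≡ σ → y ≡ u) × (¬ (τ ≡ σ) → y ≡ 𝟘)

  Bind : (St → W) → W → W → Set
  Bind f m r = ∀ τ → IsSum (λ σ → fun m σ · fun (f σ) τ) (fun r τ)

  data Test : Set where
    prim  : (St → Bool) → Test
    true  : Test
    false : Test
    _or_  : Test → Test → Test
    _and_ : Test → Test → Test
    neg   : Test → Test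

  evT : Test → St → Bool
  evT (prim t) σ  = t σ
  evT true σ      = Bool.true
  evT false σ     = Bool.false
  evT (b or c) σ  = evT b σ ∨ evT c σ
  evT (b and c) σ = evT b σ ∧ evT c σ
  evT (neg b) σ   = not (evT b σ)

  data Exp : Set where
    test  : Test → Exp
    const : U → Exp

  ev : Exp → St → U
  ev (test b) σ  = if evT b σ then 𝟙 else 𝟘
  ev (const u) σ = u

  data Cmd : Set where
    skip   : Cmd
    _⨾_    : Cmd → Cmd → Cmd
    _⊕c_   : Cmd → Cmd → Cmd
    assume : Exp → Cmd
    iter   : Cmd → Exp → Exp → Cmd
    act    : Act → Cmd

  PhiRel : Exp → Exp → (St → W) → (St → W) → (St → W) → Set
  PhiRel e e' g h h' = ∀ σ → ∃ λ (b : W) → Bind h (g σ) b ×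
    (∀ τ → ∃ λ y → PointVal 𝟙 σ τ y ×
       Plus (ev e σ · fun b τ) (ev e' σ · y) (fun (h' σ) τ))

  IsLfp : Exp → Exp → (St → W) → (St → W) → Set
  IsLfp e e' g f = PhiRel e e' g f f ×
    (∀ h → PhiRel e e' g h h → ∀ σ τ → fun (f σ) τ ≤ fun (h σ) τ)

  module Semantics (⟦_⟧a : Act → St → W) where
    data Denotes : Cmd → (St → W) → Set where
      d-skip   : ∀ {f} → (∀ σ τ → PointVal 𝟙 σ τ (fun (f σ) τ)) → Denotes skip f
      d-seq    : ∀ {C₁ C₂ f₁ f₂ f} → Denotes C₁ f₁ → Denotes C₂ f₂ →
                 (∀ σ → Bind f₂ (f₁ σ) (f σ)) → Denotes (C₁ ⨾ C₂) f
      d-plus   : ∀ {C₁ C₂ f₁ f₂ f} → Denotes C₁ f₁ → Denotes C₂ f₂ →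
                 (∀ σ τ → Plus (fun (f₁ σ) τ) (fun (f₂ σ) τ) (fun (f σ) τ)) →
                 Denotes (C₁ ⊕c C₂) f
      d-assume : ∀ {e f} → (∀ σ τ → PointVal (ev e σ) σ τ (fun (f σ) τ)) →
                 Denotes (assume e) f
      d-iter   : ∀ {C e e' g f} → Denotes C g → IsLfp e e' g f →
                 Denotes (iter C e e') f
      d-act    : ∀ {a f} → (∀ σ τ → fun (f σ) τ ≡ fun (⟦ a ⟧a σ) τ) → Denotes (act a) f

    WellFormed : Cmd → Set
    WellFormed C = ∃ λ f → Denotes C f

  Assn : Set₁
  Assn = W → Set

  _⊆_ : Assn → Assn → Set
  φ ⊆ ψ = ∀ m → φ m → ψ m

  ⊤A : Assn
  ⊤A _ = ⊤

  ⊥A : Assn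
  ⊥A _ = ⊥

  _∧A_ : Assn → Assn → Assn
  (φ ∧A ψ) m = φ m × ψ m

  _∨A_ : Assn → Assn → Assn
  (φ ∨A ψ) m = φ m ⊎ ψ m

  ExistsA : (T : Set) → (T → Assn) → Assn
  ExistsA T φ m = Σ T λ t → φ t m

  IsSumW : {T : Set} → (T → W) → W → Set
  IsSumW ms m = ∀ τ → IsSum (λ t → fun (ms t) τ) (fun m τ)

  BigOplus : (T : Set) → (T → Assn) → Assn
  BigOplus T φ m = Σ (T → W) λ ms → (∀ t → φ t (ms t)) × IsSumW ms m

  _⊕A_ : Assn → Assn → Assn
  (φ ⊕A ψ) m = ∃ λ m₁ → ∃ λ m₂ → φ m₁ × ψ m₂ ×
               (∀ τ → Plus (fun m₁ τ) (fun m₂ τ) (fun m τ))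

  _⊙ˡ_ : U → Assn → Assn
  (u ⊙ˡ φ) m = ∃ λ m' → φ m' × (∀ τ → fun m τ ≡ u · fun m' τ)

  _⊙ʳ_ : Assn → U → Assn
  (φ ⊙ʳ u) m = ∃ λ m' → φ m' × (∀ τ → fun m τ ≡ fun m' τ · u)

  Mass : W → U → Set
  Mass m u = IsSum (fun m) u

  supp⊆ : W → (St → Set) → Set
  supp⊆ m P = ∀ σ → ¬ (fun m σ ≡ 𝟘) → P σ

  -- [P]_u, [P], □P
  Sharp : (St → Set) → U → Assn
  Sharp P u m = Mass m u × supp⊆ m P

  Sharp1 : (St → Set) → Assn
  Sharp1 P = Sharp P 𝟙

  Box : (St → Set) → Assn
  Box P m = supp⊆ m P

  _⊨_≐_ : Assn → Exp → U → Set
  φ ⊨ e ≐ u = ∀ m → φ m → ∀ σ → ¬ (fun m σ ≡ 𝟘) → ev e σ ≡ u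

  Converges : (ℕ → Assn) → Assn → Set
  Converges ψ ψ∞ = ∀ (ms : ℕ → W) → (∀ n → ψ n (ms n)) →
                   ∃ λ m → IsSumW ms m × ψ∞ m

  module Proof (Γ : Assn → Act → Assn → Set) where
    data ⊢ : Assn → Cmd → Assn → Set₁ where
      r-ax     : ∀ {φ a ψ} → Γ φ a ψ → ⊢ φ (act a) ψ
      r-skip   : ∀ {φ} → ⊢ φ skip φ
      r-seq    : ∀ {φ ψ θ C₁ C₂} → ⊢ φ C₁ ψ → ⊢ ψ C₂ θ → ⊢ φ (C₁ ⨾ C₂) θ
      r-plus   : ∀ {φ ψ₁ ψ₂ C₁ C₂} → ⊢ φ C₁ ψ₁ → ⊢ φ C₂ ψ₂ → ⊢ φ (C₁ ⊕c C₂) (ψ₁ ⊕A ψ₂)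
      r-assume : ∀ {φ e u} → φ ⊨ e ≐ u → ⊢ φ (assume e) (φ ⊙ʳ u)
      r-iter   : ∀ {C e e'} (φ ψ : ℕ → Assn) (ψ∞ : Assn) → Converges ψ ψ∞ →
                 (∀ n → ⊢ (φ n) (assume e ⨾ C) (φ (suc n))) →
                 (∀ n → ⊢ (φ n) (assume e') (ψ n)) →
                 ⊢ (φ zero) (iter C e e') ψ∞
      r-false  : ∀ {C φ} → ⊢ ⊥A C φ
      r-true   : ∀ {C φ} → ⊢ φ C ⊤A
      r-scale  : ∀ {φ C ψ} u → ⊢ φ C ψ → ⊢ (u ⊙ˡ φ) C (u ⊙ˡ ψ)
      r-disj   : ∀ {φ₁ φ₂ C ψ₁ ψ₂} → ⊢ φ₁ C ψ₁ → ⊢ φ₂ C ψ₂ → ⊢ (φ₁ ∨A φ₂) C (ψ₁ ∨A ψ₂)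
      r-conj   : ∀ {φ₁ φ₂ C ψ₁ ψ₂} → ⊢ φ₁ C ψ₁ → ⊢ φ₂ C ψ₂ → ⊢ (φ₁ ∧A φ₂) C (ψ₁ ∧A ψ₂)
      r-choice : ∀ {C} (T : Set) (φ φ' : T → Assn) → (∀ t → ⊢ (φ t) C (φ' t)) →
                 ⊢ (BigOplus T φ) C (BigOplus T φ')
      r-exists : ∀ {C} (T : Set) (φ φ' : T → Assn) → (∀ t → ⊢ (φ t) C (φ' t)) →
                 ⊢ (ExistsA T φ) C (ExistsA T φ')
      r-conseq : ∀ {φ φ' C ψ ψ'} → φ' ⊆ φ → ⊢ φ C ψ → ψ ⊆ ψ' → ⊢ φ' C ψ'

{-# OPTIONS --safe #-}
-- Every m ∈ □P is the countable sum ⊕_σ m(σ)·η(σ).  When m(σ) ≠ 𝟘 the summand lies in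
-- m(σ) ⊙ [P], since η(σ) ∈ [P]; otherwise it lies in 𝟘 ⊙ ⊤, the assertion "m = 0",
-- which no program can leave.  Scaling the hypothesis by m(σ) and combining the summands
-- with (Choice) gives a postcondition of sums of elements of □Q, and such sums stay in □Q.
module Submission where

open import Defs
open import Level using (0ℓ)
open import Axiom.ExcludedMiddle using (ExcludedMiddle)
open import Data.List using (List; []; _∷_; map)
open import Data.List.Relation.Unary.All as All using (All; []; _∷_)
open import Data.List.Relation.Unary.AllPairs using ([]; _∷_)
open import Data.List.Relation.Unary.Unique.Propositional using (Unique)
open import Data.Maybe using (just)
open import Data.Product using (∃; _×_; _,_)
open import Data.Sum using (inj₁; inj₂)
open import Data.Unit using (tt)
open import Data.Empty using (⊥-elim)
open import Relation.Nullary using (¬_; Dec; yes; no)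
open import Relation.Nullary.Decidable using (decidable-stable)
open import Relation.Binary.Definitions using (DecidableEquality)
open import Relation.Binary.PropositionalEquality
  using (_≡_; _≢_; refl; sym; trans; cong; subst; ≢-sym)

module PartialSemiringProperties (A : PartialSemiring) where
  open PartialSemiring A

  ≤-refl : ∀ a → a ≤ a
  ≤-refl a = 𝟘 , +-identityʳ a

  𝟘≤ : ∀ a → 𝟘 ≤ a
  𝟘≤ a = a , +-comm (+-identityʳ a)

  +-identityˡ : ∀ a → Plus 𝟘 a a
  +-identityˡ a = +-comm (+-identityʳ a)

  FinSum-functional : ∀ {xs s t} → FinSum xs s → FinSum xs t → s ≡ t
  FinSum-functional fs-[] fs-[] = refl
  FinSum-functional (fs-∷ fs p) (fs-∷ gs q) rewrite FinSum-functional fs gs = +-functional p q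

  FinSum-zeros : ∀ {I : Set} {f : I → U} {F : List I} → All (λ i → f i ≡ 𝟘) F →
                 FinSum (map f F) 𝟘
  FinSum-zeros [] = fs-[]
  FinSum-zeros (fx≡𝟘 ∷ zs) =
    fs-∷ (FinSum-zeros zs) (subst (λ a → Plus a 𝟘 𝟘) (sym fx≡𝟘) (+-identityʳ 𝟘))

  IsSum-zeros : ∀ {I : Set} {f : I → U} {s} → (∀ i → f i ≡ 𝟘) → IsSum f s → s ≡ 𝟘
  IsSum-zeros {f = f} {s} f≡𝟘 (_ , least) = ≤-antisym s≤𝟘 (𝟘≤ s)
    where
    s≤𝟘 : s ≤ 𝟘
    s≤𝟘 = least 𝟘 λ F _ t fs →
      subst (_≤ 𝟘) (FinSum-functional (FinSum-zeros (All.universal f≡𝟘 F)) fs) (≤-refl 𝟘)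

  IsSum-singleton : ∀ {I : Set} (f : I → U) (i₀ : I) → (∀ i → Dec (i ≡ i₀)) →
                    (∀ i → i ≢ i₀ → f i ≡ 𝟘) → IsSum f (f i₀)
  IsSum-singleton {I} f i₀ _≟i₀ vanish = partialSums , least
    where
    partialSums : ∀ (F : List I) → Unique F → ∃ λ t → FinSum (map f F) t × t ≤ f i₀
    partialSums [] _ = 𝟘 , fs-[] , 𝟘≤ (f i₀)
    partialSums (x ∷ F) (x∉F ∷ uniqueF) with x ≟i₀
    ... | yes refl =
      f i₀ , fs-∷ (FinSum-zeros (All.map (λ {i} i₀≢i → vanish i (≢-sym i₀≢i)) x∉F))
                  (+-identityʳ (f i₀)) , ≤-refl (f i₀)
    ... | no x≢i₀ with partialSums F uniqueF
    ...   | t , fs , t≤ =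
      t , fs-∷ fs (subst (λ a → Plus a t t) (sym (vanish x x≢i₀)) (+-identityˡ t)) , t≤

    least : ∀ b → (∀ F → Unique F → ∀ t → FinSum (map f F) t → t ≤ b) → f i₀ ≤ b
    least b bound = bound (i₀ ∷ []) ([] ∷ []) (f i₀) (fs-∷ fs-[] (+-identityʳ (f i₀)))

module PointMass (A : PartialSemiring) (St Act : Set) (_≟_ : DecidableEquality St) where
  open PartialSemiring A
  open OL A St Act
  open PartialSemiringProperties A

  point : St → U → St → U
  point σ u τ with τ ≟ σ
  ... | yes _ = u
  ... | no  _ = 𝟘

  point-self : ∀ σ u → point σ u σ ≡ u
  point-self σ u with σ ≟ σ
  ... | yes _   = refl
  ... | no σ≢σ = ⊥-elim (σ≢σ refl)

  point-≢ : ∀ {σ τ} u → τ ≢ σ → point σ u τ ≡ 𝟘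
  point-≢ {σ} {τ} u τ≢σ with τ ≟ σ
  ... | yes τ≡σ = ⊥-elim (τ≢σ τ≡σ)
  ... | no  _   = refl

  point-supp : ∀ {σ τ u} → ¬ point σ u τ ≡ 𝟘 → τ ≡ σ
  point-supp {σ} {τ} nonzero with τ ≟ σ
  ... | yes τ≡σ = τ≡σ
  ... | no  _   = ⊥-elim (nonzero refl)

  point-scale : ∀ σ u τ → point σ u τ ≡ u · point σ 𝟙 τ
  point-scale σ u τ with τ ≟ σ
  ... | yes _ = sym (·-identityʳ u)
  ... | no  _ = sym (zeroʳ u)

  point-mass : ∀ σ u → IsSum (point σ u) u
  point-mass σ u =
    subst (IsSum (point σ u)) (point-self σ u)
      (IsSum-singleton (point σ u) σ (_≟ σ) λ _ → point-≢ u)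

  pointMass : St → U → W
  pointMass σ u = record
    { fun       = point σ u
    ; countable = (λ _ → just σ) , λ τ nonzero → 0 , cong just (sym (point-supp nonzero))
    ; mass      = u , point-mass σ u
    }

  η∈Sharp1 : ∀ {P : St → Set} {σ} → P σ → Sharp1 P (pointMass σ 𝟙)
  η∈Sharp1 {P} Pσ = point-mass _ 𝟙 , λ τ nonzero → subst P (sym (point-supp nonzero)) Pσ

  IsSumW-pointMasses : ∀ m → IsSumW (λ σ → pointMass σ (fun m σ)) m
  IsSumW-pointMasses m τ =
    subst (IsSum (λ σ → point σ (fun m σ) τ)) (point-self τ (fun m τ))
      (IsSum-singleton (λ σ → point σ (fun m σ) τ) τ (_≟ τ)
        λ σ σ≢τ → point-≢ (fun m σ) (≢-sym σ≢τ))

module ScaledAssertions (A : PartialSemiring) (St Act : Set) where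
  open PartialSemiring A
  open OL A St Act

  -- 𝟘 ⊙ ⊤ holds exactly of the zero weighting.
  ScaledOrZero : Assn → Assn
  ScaledOrZero φ = ExistsA U λ u → (u ⊙ˡ φ) ∨A (𝟘 ⊙ˡ ⊤A)

  ⊢-ScaledOrZero : ∀ {Γ C φ ψ} → Proof.⊢ Γ φ C ψ →
                   Proof.⊢ Γ (ScaledOrZero φ) C (ScaledOrZero ψ)
  ⊢-ScaledOrZero {Γ} H =
    r-exists U _ _ λ u → r-disj (r-scale u H) (r-scale 𝟘 r-true)
    where open Proof Γ

  ⊙ˡ-Box : ∀ {Q} u → (u ⊙ˡ Box Q) ⊆ Box Q
  ⊙ˡ-Box u m (m' , boxQ , m≡um') τ nonzero = boxQ τ λ m'τ≡𝟘 →
    nonzero (trans (m≡um' τ) (trans (cong (u ·_) m'τ≡𝟘) (zeroʳ u)))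

  𝟘⊙ˡ-Box : ∀ {Q φ} → (𝟘 ⊙ˡ φ) ⊆ Box Q
  𝟘⊙ˡ-Box m (_ , _ , m≡𝟘m') τ nonzero = ⊥-elim (nonzero (trans (m≡𝟘m' τ) (zeroˡ _)))

  ScaledOrZero-Box : ∀ {Q} → ScaledOrZero (Box Q) ⊆ Box Q
  ScaledOrZero-Box m (u , inj₁ scaled) = ⊙ˡ-Box u m scaled
  ScaledOrZero-Box m (u , inj₂ zero)   = 𝟘⊙ˡ-Box m zero

module Classical (em : ExcludedMiddle 0ℓ) (A : PartialSemiring) (St Act : Set) where
  open PartialSemiring A
  open OL A St Act
  open PartialSemiringProperties A
  open PointMass A St Act (λ _ _ → em)
  open ScaledAssertions A St Act

  Box-vanish : ∀ {Q m τ} → Box Q m → ¬ Q τ → fun m τ ≡ 𝟘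
  Box-vanish {τ = τ} boxQ ¬Qτ = decidable-stable em λ nonzero → ¬Qτ (boxQ τ nonzero)

  BigOplus-Box : ∀ {Q T φ} → (∀ t → φ t ⊆ Box Q) → BigOplus T φ ⊆ Box Q
  BigOplus-Box {Q} φ⊆Box m (ms , φms , sum) τ nonzero = decidable-stable em λ ¬Qτ →
    nonzero (IsSum-zeros (λ t → Box-vanish {Q} {ms t} (φ⊆Box t (ms t) (φms t)) ¬Qτ) (sum τ))

  Box⊆BigOplus-ScaledOrZero : ∀ {P} → Box P ⊆ BigOplus St (λ _ → ScaledOrZero (Sharp1 P))
  Box⊆BigOplus-ScaledOrZero {P} m boxP =
    (λ σ → pointMass σ (fun m σ)) , summand , IsSumW-pointMasses m
    where
    summand : ∀ σ → ScaledOrZero (Sharp1 P) (pointMass σ (fun m σ))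
    summand σ with em {fun m σ ≡ 𝟘}
    ... | yes mσ≡𝟘 = fun m σ , inj₂ (pointMass σ 𝟙 , tt , λ τ →
                       trans (point-scale σ (fun m σ) τ) (cong (_· point σ 𝟙 τ) mσ≡𝟘))
    ... | no nonzero =
      fun m σ , inj₁ (pointMass σ 𝟙 , η∈Sharp1 (boxP σ nonzero) , point-scale σ (fun m σ))

  ⊢-Sharp1⇒⊢-Box : ∀ {Γ C P Q} → Proof.⊢ Γ (Sharp1 P) C (Box Q) →
                   Proof.⊢ Γ (Box P) C (Box Q)
  ⊢-Sharp1⇒⊢-Box {Γ} H =
    r-conseq Box⊆BigOplus-ScaledOrZero
      (r-choice St _ _ λ _ → ⊢-ScaledOrZero H)
      (BigOplus-Box λ _ → ScaledOrZero-Box)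
    where open Proof Γ

lemmaE1 : ExcludedMiddle 0ℓ →
          (A : PartialSemiring) (St : Set) (Act : Set)
          (⟦_⟧a : Act → St → OL.W A St Act)
          (Γ : OL.Assn A St Act → Act → OL.Assn A St Act → Set)
          (C : OL.Cmd A St Act) →
          OL.Semantics.WellFormed A St Act ⟦_⟧a C →
          (P Q : St → Set) →
          OL.Proof.⊢ A St Act Γ (OL.Sharp1 A St Act P) C (OL.Box A St Act Q) →
          OL.Proof.⊢ A St Act Γ (OL.Box A St Act P) C (OL.Box A St Act Q)
lemmaE1 em A St Act _ Γ C _ P Q = Classical.⊢-Sharp1⇒⊢-Box em A St Act
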